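{- Let $L$ be a finite lattice. Then the lattice of weak factorization systems on $L$ is distributive if and only if $|L|\leq 2$.
   Context: A finite lattice $(L,\leq)$ is viewed as a category with a unique morphism $a\to b$ whenever $a\leq b$; a morphism is identified with a relation $(a,b)$, $a\leq b$. A morphism $(a,b)$ lifts on the left a morphism $(c,d)$ if for every commutative square $a\to c$, $b\to d$ (i.e. whenever $a\leq c$ and $b\leq d$) there is a diagonal $b\to c$, i.e. $b\leq c$. A weak factorization system on $L$ is a pair $(\mathcal{L},\mathcal{R})$ of sets of relations such that every relation $a\leq b$ factors as $a\leq x\leq b$ with $(a,x)\in\mathcal{L}$ and $(x,b)\in\mathcal{R}$, $\mathcal{L}$ is the set of all relations that lift on the left every relation of $\mathcal{R}$, and $\mathcal{R}$ is the set of all relations that every relation of $\mathcal{L}$ lifts on the left. They are ordered by $(\mathcal{L},\mathcal{R})\preceq(\mathcal{L}',\mathcal{R}')$ iff $\mathcal{R}\subseteq\mathcal{R}'$ (equivalently $\mathcal{L}'\subseteq\mathcal{L}$); this poset is a lattice. -}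

module Defs where

open import Level using (0ℓ)
open import Data.Nat using (ℕ)
open import Data.Fin using (Fin)
open import Data.Product using (Σ; ∃; _×_; _,_)
open import Function.Bundles using (_⇔_)
open import Relation.Binary using (Rel)
open import Relation.Binary.Core using ()
open import Algebra.Core using (Op₂)
open import Relation.Binary.PropositionalEquality using (_≡_)
open import Relation.Binary.Lattice.Structures using (IsLattice)

record FiniteLattice (n : ℕ) : Set₁ where
  field
    _≤_ : Rel (Fin n) 0ℓ
    _∨_ : Op₂ (Fin n)
    _∧_ : Op₂ (Fin n)
    isLattice : IsLattice _≡_ _≤_ _∨_ _∧_

module _ {n : ℕ} (L : FiniteLattice n) where
  open FiniteLattice L

  -- (a,b) lifts on the left (c,d): every square a ≤ c, b ≤ d has a diagonal b ≤ c.
  LiftsAgainst : Fin n → Fin n → Fin n → Fin n → Set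
  LiftsAgainst a b c d = a ≤ c → b ≤ d → b ≤ c

  MorSet : Set₁
  MorSet = Fin n → Fin n → Set

  LeftLifting : MorSet → MorSet
  LeftLifting R a b = a ≤ b × (∀ c d → c ≤ d → R c d → LiftsAgainst a b c d)

  RightLifting : MorSet → MorSet
  RightLifting 𝓛 c d = c ≤ d × (∀ a b → a ≤ b → 𝓛 a b → LiftsAgainst a b c d)

  record WFS : Set₁ where
    field
      𝓛 : MorSet
      𝓡 : MorSet
      factor : ∀ a b → a ≤ b → ∃ λ x → a ≤ x × x ≤ b × 𝓛 a x × 𝓡 x b
      𝓛-char : ∀ a b → 𝓛 a b ⇔ LeftLifting 𝓡 a b
      𝓡-char : ∀ a b → 𝓡 a b ⇔ RightLifting 𝓛 a b

  _≼_ : WFS → WFS → Set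
  W ≼ W' = ∀ a b → WFS.𝓡 W a b → WFS.𝓡 W' a b

  _≈W_ : WFS → WFS → Set
  W ≈W W' = (W ≼ W') × (W' ≼ W)

  IsJoin : WFS → WFS → WFS → Set₁
  IsJoin x y j = x ≼ j × y ≼ j × (∀ z → x ≼ z → y ≼ z → j ≼ z)

  IsMeet : WFS → WFS → WFS → Set₁
  IsMeet x y m = m ≼ x × m ≼ y × (∀ z → z ≼ x → z ≼ y → z ≼ m)

  -- The lattice (WFS, ≼) is distributive: x ∧ (y ∨ z) = (x ∧ y) ∨ (x ∧ z),
  -- stated for arbitrary joins/meets in the poset (they are unique up to ≈W).
  WFSDistributive : Set₁
  WFSDistributive = ∀ x y z j m p q r →
    IsJoin y z j → IsMeet x j m → IsMeet x y p → IsMeet x z q → IsJoin p q r →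
    m ≈W r

-- Right classes contain every identity and are closed under composition. If |L| ≤ 2 there
-- is at most one relation a ≤ b with a ≢ b, so any two weak factorization systems are
-- comparable, and a chain is distributive. If |L| ≥ 3, pick e ∉ {⊥, ⊤} and consider the
-- systems whose right classes consist of the identities together with
--   X : all ⊥ ≤ v,   Y : ⊥ ≤ v for v ≤ e,   Z : all e ∧ v ≤ v.
-- Y ∨ Z contains each ⊥ ≤ v as the composite ⊥ ≤ e ∧ v ≤ v, so X ∧ (Y ∨ Z) = X. But X ∧ Z
-- only has ⊥ ≤ v for e ∧ v ≡ ⊥, so (X ∧ Y) ∨ (X ∧ Z) = Y ∨ (X ∧ Z) misses ⊥ ≤ ⊤.
module Submission where

open import Level using (0ℓ)
open import Algebra.Core using (Op₂)
open import Data.Nat using (ℕ; zero; suc; _+_; _≤_; z≤n; s≤s)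
open import Data.Fin using (Fin; zero; suc; _≟_; punchIn; punchOut)
open import Data.Fin.Properties using (any?; punchInᵢ≢i; punchIn-injective; punchIn-punchOut)
open import Data.Vec.Functional using (Vector; foldr; tail)
open import Data.Product using (∃; ∃₂; _×_; _,_; proj₁; proj₂)
open import Data.Sum as Sum using (_⊎_; inj₁; inj₂)
open import Data.Empty using (⊥-elim)
open import Data.Unit using (tt)
open import Function using (_∘_; flip; id)
open import Function.Bundles using (_⇔_; mk⇔; Equivalence)
open import Relation.Nullary using (¬_; Dec; yes; no; ¬?)
open import Relation.Nullary.Decidable using (_×-dec_; map′; decidable-stable)
open import Relation.Unary using (Pred; Decidable; U; _⊆_; _∪_)
open import Relation.Unary.Properties using (U?; _∪?_)
open import Relation.Binary.Core using (Rel)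
open import Relation.Binary.Definitions using (Transitive; Total; Minimum; Maximum; _Respects_)
open import Relation.Binary.PropositionalEquality using (_≡_; _≢_; refl; sym; trans; subst)
open import Relation.Binary.Lattice.Structures using (IsLattice)
open import Defs

foldr-lowerBound : ∀ {a ℓ} {A : Set a} {_≤_ : Rel A ℓ} {_∙_ : Op₂ A} → Transitive _≤_ →
                   (∀ x y → (x ∙ y) ≤ x) → (∀ x y → (x ∙ y) ≤ y) →
                   ∀ {k} z (xs : Vector A k) i → foldr _∙_ z xs ≤ xs i
foldr-lowerBound ≤-trans ∙≤ˡ ∙≤ʳ z xs zero    = ∙≤ˡ _ _
foldr-lowerBound ≤-trans ∙≤ˡ ∙≤ʳ z xs (suc i) =
  ≤-trans (∙≤ʳ _ _) (foldr-lowerBound ≤-trans ∙≤ˡ ∙≤ʳ z (tail xs) i)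

avoid₂ : ∀ {k} (a b : Fin (3 + k)) → ∃ λ e → e ≢ a × e ≢ b
avoid₂ {k} a b with a ≟ b
... | yes refl = punchIn a zero , punchInᵢ≢i a zero , punchInᵢ≢i a zero
... | no a≢b   = punchIn a i , punchInᵢ≢i a i , i≢b
  where
  j i : Fin (2 + k)
  j = punchOut a≢b
  i = punchIn j zero
  i≢b : punchIn a i ≢ b
  i≢b eq = punchInᵢ≢i j zero
             (punchIn-injective a i j (trans eq (sym (punchIn-punchOut a≢b))))

≤2-cover : ∀ {n} → n ≤ 2 → {a b : Fin n} → a ≢ b → ∀ c → c ≡ a ⊎ c ≡ b
≤2-cover _               {zero}     {zero}     a≢b _          = ⊥-elim (a≢b refl)
≤2-cover (s≤s (s≤s z≤n)) {suc zero} {suc zero} a≢b _          = ⊥-elim (a≢b refl)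
≤2-cover _               {zero}     {suc _}    _   zero       = inj₁ refl
≤2-cover _               {suc _}    {zero}     _   zero       = inj₂ refl
≤2-cover (s≤s (s≤s z≤n)) {zero}     {suc zero} _   (suc zero) = inj₂ refl
≤2-cover (s≤s (s≤s z≤n)) {suc zero} {zero}     _   (suc zero) = inj₁ refl

module _ {n : ℕ} (L : FiniteLattice n) where
  open FiniteLattice L renaming (_≤_ to _⊑_)
  open IsLattice isLattice
    using (antisym; x∧y≤x; x∧y≤y; ∧-greatest; x≤x∨y; y≤x∨y)
    renaming (refl to ⊑-refl; trans to ⊑-trans)
  open WFS
  open Equivalence using (to; from)

  _⊑?_ : ∀ a b → Dec (a ⊑ b)
  a ⊑? b = map′ (λ a∧b≡a → subst (_⊑ b) a∧b≡a (x∧y≤y a b))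
                (λ a⊑b → antisym (x∧y≤x a b) (∧-greatest ⊑-refl a⊑b))
                (a ∧ b ≟ a)

  minimum : Fin n → ∃ (Minimum _⊑_)
  minimum z = foldr _∧_ z id , foldr-lowerBound ⊑-trans x∧y≤x x∧y≤y z id

  maximum : Fin n → ∃ (Maximum _⊑_)
  maximum z = foldr _∨_ z id , foldr-lowerBound (flip ⊑-trans) x≤x∨y y≤x∨y z id

  module _ (W : WFS L) where

    𝓡-lifting : ∀ {c d} → 𝓡 W c d → RightLifting L (𝓛 W) c d
    𝓡-lifting = to (𝓡-char W _ _)

    𝓡⇒⊑ : ∀ {c d} → 𝓡 W c d → c ⊑ d
    𝓡⇒⊑ = proj₁ ∘ 𝓡-lifting

    𝓡-reflexive : ∀ {c d} → c ≡ d → 𝓡 W c d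
    𝓡-reflexive {c} refl = from (𝓡-char W c c) (⊑-refl , λ _ _ _ _ _ b⊑c → b⊑c)

    𝓡-trans : ∀ {c d f} → 𝓡 W c d → 𝓡 W d f → 𝓡 W c f
    𝓡-trans {c} {d} {f} r s = from (𝓡-char W c f) (⊑-trans (𝓡⇒⊑ r) (𝓡⇒⊑ s) , lift)
      where
      lift : ∀ a b → a ⊑ b → 𝓛 W a b → LiftsAgainst L a b c f
      lift a b a⊑b l a⊑c b⊑f =
        proj₂ (𝓡-lifting r) a b a⊑b l a⊑c
          (proj₂ (𝓡-lifting s) a b a⊑b l (⊑-trans a⊑c (𝓡⇒⊑ r)) b⊑f)

    -- Factor a ≤ x ≤ b; then (a , b) ∈ 𝓡 iff x ≡ a, as (a , x) ∈ 𝓛 lifts against (a , b).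
    𝓡-dec : ∀ a b → Dec (𝓡 W a b)
    𝓡-dec a b with a ⊑? b
    ... | no a⋢b = no (a⋢b ∘ 𝓡⇒⊑)
    ... | yes a⊑b with factor W a b a⊑b
    ...   | x , a⊑x , x⊑b , l , r with x ≟ a
    ...     | yes refl = yes r
    ...     | no x≢a   =
              no λ r′ → x≢a (antisym (proj₂ (𝓡-lifting r′) a x a⊑x l ⊑-refl x⊑b) a⊑x)

  ≼-refl : ∀ W → _≼_ L W W
  ≼-refl W _ _ r = r

  ≼-trans : ∀ {U V W} → _≼_ L U V → _≼_ L V W → _≼_ L U W
  ≼-trans U≼V V≼W a b = V≼W a b ∘ U≼V a b

  ≼-or-counterexample : ∀ W W′ → _≼_ L W W′ ⊎ ∃₂ λ a b → 𝓡 W a b × ¬ 𝓡 W′ a b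
  ≼-or-counterexample W W′
    with any? (λ a → any? (λ b → 𝓡-dec W a b ×-dec ¬? (𝓡-dec W′ a b)))
  ... | yes (a , b , r , ¬r′) = inj₂ (a , b , r , ¬r′)
  ... | no ∄ = inj₁ λ a b r →
    decidable-stable (𝓡-dec W′ a b) λ ¬r′ → ∄ (a , b , r , ¬r′)

  meet-of-≼ : ∀ {x y} → _≼_ L x y → IsMeet L x y x
  meet-of-≼ {x} x≼y = ≼-refl x , x≼y , λ _ z≼x _ → z≼x

  meet-of-≽ : ∀ {x y} → _≼_ L y x → IsMeet L x y y
  meet-of-≽ {y = y} y≼x = y≼x , ≼-refl y , λ _ _ z≼y → z≼y

  total⇒distributive : Total (_≼_ L) → WFSDistributive L
  total⇒distributive total x y z j m p q r
    (y≼j , z≼j , j-least) (m≼x , m≼j , m-greatest) (p≼x , p≼y , p-greatest)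
    (q≼x , q≼z , q-greatest) (p≼r , q≼r , r-least) = m≼r , r≼m
    where
    r≼m : _≼_ L r m
    r≼m = m-greatest r (r-least x p≼x q≼x)
            (r-least j (≼-trans {p} {y} {j} p≼y y≼j) (≼-trans {q} {z} {j} q≼z z≼j))
    -- In a chain y ∨ z is y or z, so x ∧ (y ∨ z) is x ∧ y or x ∧ z.
    m≼r : _≼_ L m r
    m≼r with total y z
    ... | inj₁ y≼z = ≼-trans {m} {q} {r} (q-greatest m m≼x (≼-trans {m} {j} {z} m≼j j≼z)) q≼r
      where j≼z : _≼_ L j z
            j≼z = j-least z y≼z (≼-refl z)
    ... | inj₂ z≼y = ≼-trans {m} {p} {r} (p-greatest m m≼x (≼-trans {m} {j} {y} m≼j j≼y)) p≼r
      where j≼y : _≼_ L j y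
            j≼y = j-least y (≼-refl y) z≼y

  ≤2-strict-unique : n ≤ 2 → ∀ {a b c d} → a ⊑ b → a ≢ b → c ⊑ d → c ≢ d → c ≡ a × d ≡ b
  ≤2-strict-unique n≤2 {c = c} {d} a⊑b a≢b c⊑d c≢d
    with ≤2-cover n≤2 a≢b c | ≤2-cover n≤2 a≢b d
  ... | inj₁ refl | inj₁ refl = ⊥-elim (c≢d refl)
  ... | inj₁ refl | inj₂ refl = refl , refl
  ... | inj₂ refl | inj₁ refl = ⊥-elim (a≢b (antisym a⊑b c⊑d))
  ... | inj₂ refl | inj₂ refl = ⊥-elim (c≢d refl)

  ≤2⇒≼-total : n ≤ 2 → Total (_≼_ L)
  ≤2⇒≼-total n≤2 W W′ with ≼-or-counterexample W W′
  ... | inj₁ W≼W′ = inj₁ W≼W′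
  ... | inj₂ (a , b , r , ¬r′) = inj₂ W′≼W
    where
    W′≼W : _≼_ L W′ W
    W′≼W c d r′ with c ≟ d
    ... | yes c≡d = 𝓡-reflexive W c≡d
    ... | no c≢d
      with ≤2-strict-unique n≤2 (𝓡⇒⊑ W r) (¬r′ ∘ 𝓡-reflexive W′) (𝓡⇒⊑ W′ r′) c≢d
    ... | refl , refl = r

  Factorises : MorSet L → Set
  Factorises R = ∀ a b → a ⊑ b → ∃ λ x → a ⊑ x × x ⊑ b × LeftLifting L R a x × R x b

  fromRightClass : (R : MorSet L) → (∀ {c d} → R c d → c ⊑ d) → Factorises R → WFS L
  fromRightClass R R⊆⊑ fac = record
    { 𝓛      = LeftLifting L R
    ; 𝓡      = R
    ; factor = fac
    ; 𝓛-char = λ _ _ → mk⇔ id id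
    ; 𝓡-char = λ c d → mk⇔ (λ r → R⊆⊑ r , λ _ _ _ (_ , lift) → lift c d (R⊆⊑ r) r)
                            (λ (c⊑d , lifts) → retract c⊑d lifts (fac c d c⊑d))
    }
    where
    retract : ∀ {c d} → c ⊑ d →
              (∀ a b → a ⊑ b → LeftLifting L R a b → LiftsAgainst L a b c d) →
              (∃ λ x → c ⊑ x × x ⊑ d × LeftLifting L R c x × R x d) → R c d
    retract {c} {d} c⊑d lifts (x , c⊑x , x⊑d , l , r) =
      subst (λ t → R t d) (antisym (lifts c x c⊑x l ⊑-refl x⊑d) c⊑x) r

  𝓡-factorises : (W : WFS L) → Factorises (𝓡 W)
  𝓡-factorises W a b a⊑b with factor W a b a⊑b
  ... | x , a⊑x , x⊑b , l , r = x , a⊑x , x⊑b , to (𝓛-char W a x) l , r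

  identity-leftLifting : ∀ R a → LeftLifting L R a a
  identity-leftLifting R a = ⊑-refl , λ _ _ _ _ a⊑c _ → a⊑c

  MeetArrows : Fin n → MorSet L
  MeetArrows e u v = u ≡ v ⊎ u ≡ e ∧ v

  meetArrows-factorises : ∀ e → Factorises (MeetArrows e)
  meetArrows-factorises e a b a⊑b with a ⊑? e
  ... | yes a⊑e = e ∧ b , a⊑e∧b , x∧y≤y e b , (a⊑e∧b , lift) , inj₂ refl
    where
    a⊑e∧b : a ⊑ (e ∧ b)
    a⊑e∧b = ∧-greatest a⊑e a⊑b
    lift : ∀ c d → c ⊑ d → MeetArrows e c d → LiftsAgainst L a (e ∧ b) c d
    lift c d _ (inj₁ refl) _ e∧b⊑d = e∧b⊑d
    lift c d _ (inj₂ refl) _ e∧b⊑d = ∧-greatest (x∧y≤x e b) e∧b⊑d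
  ... | no a⋢e = b , a⊑b , ⊑-refl , (a⊑b , lift) , inj₁ refl
    where
    lift : ∀ c d → c ⊑ d → MeetArrows e c d → LiftsAgainst L a b c d
    lift c d _ (inj₁ refl) _ b⊑d = b⊑d
    lift c d _ (inj₂ refl) a⊑e∧d _ = ⊥-elim (a⋢e (⊑-trans a⊑e∧d (x∧y≤x e d)))

  meetArrows : Fin n → WFS L
  meetArrows e = fromRightClass (MeetArrows e) ⊆⊑ (meetArrows-factorises e)
    where
    ⊆⊑ : ∀ {c d} → MeetArrows e c d → c ⊑ d
    ⊆⊑ (inj₁ refl) = ⊑-refl
    ⊆⊑ (inj₂ refl) = x∧y≤y e _

  record DecLowerSet : Set₁ where
    field
      member  : Pred (Fin n) 0ℓ
      member? : Decidable member
      lower   : member Respects (flip _⊑_)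
  open DecLowerSet

  _∪ˡ_ : DecLowerSet → DecLowerSet → DecLowerSet
  S ∪ˡ T = record
    { member  = member S ∪ member T
    ; member? = member? S ∪? member? T
    ; lower   = λ w⊑v → Sum.map (lower S w⊑v) (lower T w⊑v)
    }

  module _ (⊥ : Fin n) (⊥-min : Minimum _⊑_ ⊥) where

    ⊑⊥⇒≡⊥ : ∀ {a} → a ⊑ ⊥ → a ≡ ⊥
    ⊑⊥⇒≡⊥ {a} a⊑⊥ = antisym a⊑⊥ (⊥-min a)

    BotArrows : Pred (Fin n) 0ℓ → MorSet L
    BotArrows P u v = u ≡ v ⊎ (u ≡ ⊥ × P v)

    botArrows : DecLowerSet → WFS L
    botArrows S = fromRightClass (BotArrows (member S)) ⊆⊑ fac
      where
      ⊆⊑ : ∀ {c d} → BotArrows (member S) c d → c ⊑ d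
      ⊆⊑ (inj₁ refl)       = ⊑-refl
      ⊆⊑ (inj₂ (refl , _)) = ⊥-min _
      fac : Factorises (BotArrows (member S))
      fac a b a⊑b with a ≟ ⊥ ×-dec member? S b
      ... | yes r = a , ⊑-refl , a⊑b , identity-leftLifting _ a , inj₂ r
      ... | no ¬r = b , a⊑b , ⊑-refl , (a⊑b , lift) , inj₁ refl
        where
        lift : ∀ c d → c ⊑ d → BotArrows (member S) c d → LiftsAgainst L a b c d
        lift c d _ (inj₁ refl) _ b⊑d = b⊑d
        lift c d _ (inj₂ (refl , d∈S)) a⊑⊥ b⊑d =
          ⊥-elim (¬r (⊑⊥⇒≡⊥ a⊑⊥ , lower S b⊑d d∈S))

    botArrows-mono : ∀ {S T} → member S ⊆ member T → _≼_ L (botArrows S) (botArrows T)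
    botArrows-mono S⊆T _ _ (inj₁ u≡v)          = inj₁ u≡v
    botArrows-mono S⊆T _ _ (inj₂ (u≡⊥ , v∈S)) = inj₂ (u≡⊥ , S⊆T v∈S)

    botArrows-∪ : ∀ S T → IsJoin L (botArrows S) (botArrows T) (botArrows (S ∪ˡ T))
    botArrows-∪ S T =
      botArrows-mono {S} {S ∪ˡ T} inj₁ , botArrows-mono {T} {S ∪ˡ T} inj₂ , least
      where
      least : ∀ W → _≼_ L (botArrows S) W → _≼_ L (botArrows T) W →
              _≼_ L (botArrows (S ∪ˡ T)) W
      least W S≼W T≼W u v (inj₁ u≡v)                = 𝓡-reflexive W u≡v
      least W S≼W T≼W u v (inj₂ (u≡⊥ , inj₁ v∈S)) = S≼W u v (inj₂ (u≡⊥ , v∈S))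
      least W S≼W T≼W u v (inj₂ (u≡⊥ , inj₂ v∈T)) = T≼W u v (inj₂ (u≡⊥ , v∈T))

    WithBot : MorSet L → MorSet L
    WithBot R u v = R u v ⊎ u ≡ ⊥

    withBot-factorises : ∀ {R} → Factorises R → Factorises (WithBot R)
    withBot-factorises {R} fac a b a⊑b with a ≟ ⊥
    ... | yes a≡⊥ = a , ⊑-refl , a⊑b , identity-leftLifting _ a , inj₂ a≡⊥
    ... | no a≢⊥ with fac a b a⊑b
    ...   | x , a⊑x , x⊑b , (_ , lift) , r = x , a⊑x , x⊑b , (a⊑x , lift′) , inj₁ r
      where
      lift′ : ∀ c d → c ⊑ d → WithBot R c d → LiftsAgainst L a x c d
      lift′ c d c⊑d (inj₁ r′)   = lift c d c⊑d r′
      lift′ c d _   (inj₂ refl) a⊑⊥ _ = ⊥-elim (a≢⊥ (⊑⊥⇒≡⊥ a⊑⊥))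

    withBot : WFS L → WFS L
    withBot W = fromRightClass (WithBot (𝓡 W)) ⊆⊑ (withBot-factorises (𝓡-factorises W))
      where
      ⊆⊑ : ∀ {c d} → WithBot (𝓡 W) c d → c ⊑ d
      ⊆⊑ (inj₁ r)    = 𝓡⇒⊑ W r
      ⊆⊑ (inj₂ refl) = ⊥-min _

    botArrows≼withBot : ∀ S W → _≼_ L (botArrows S) (withBot W)
    botArrows≼withBot S W _ _ (inj₁ u≡v)        = inj₁ (𝓡-reflexive W u≡v)
    botArrows≼withBot S W _ _ (inj₂ (u≡⊥ , _)) = inj₂ u≡⊥

    module _ (⊤ : Fin n) (⊤-max : Maximum _⊑_ ⊤)
             (e : Fin n) (e≢⊥ : e ≢ ⊥) (e≢⊤ : e ≢ ⊤) where

      everything belowE disjointFromE : DecLowerSet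
      everything    = record { member = U ; member? = U? ; lower = λ _ _ → tt }
      belowE        = record { member = _⊑ e ; member? = _⊑? e ; lower = ⊑-trans }
      disjointFromE = record
        { member  = λ v → e ∧ v ≡ ⊥
        ; member? = λ v → e ∧ v ≟ ⊥
        ; lower   = λ {y = w} w⊑v e∧v≡⊥ → ⊑⊥⇒≡⊥ (subst ((e ∧ w) ⊑_) e∧v≡⊥
                      (∧-greatest (x∧y≤x e w) (⊑-trans (x∧y≤y e w) w⊑v)))
        }

      X Y Z Q Y∨Q : WFS L
      X = botArrows everything
      Y = botArrows belowE
      Z = meetArrows e
      Q = botArrows disjointFromE
      Y∨Q = botArrows (belowE ∪ˡ disjointFromE)

      Y∨Z≡withBotZ : IsJoin L Y Z (withBot Z)
      Y∨Z≡withBotZ = botArrows≼withBot belowE Z , (λ _ _ → inj₁) , least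
        where
        least : ∀ W → _≼_ L Y W → _≼_ L Z W → _≼_ L (withBot Z) W
        least W Y≼W Z≼W u v (inj₁ r)    = Z≼W u v r
        least W Y≼W Z≼W u v (inj₂ refl) =
          𝓡-trans W (Y≼W ⊥ (e ∧ v) (inj₂ (refl , x∧y≤x e v))) (Z≼W (e ∧ v) v (inj₂ refl))

      X∧Z≡Q : IsMeet L X Z Q
      X∧Z≡Q = botArrows-mono {disjointFromE} {everything} _ , Q≼Z , greatest
        where
        Q≼Z : _≼_ L Q Z
        Q≼Z _ _ (inj₁ u≡v)             = inj₁ u≡v
        Q≼Z _ _ (inj₂ (u≡⊥ , e∧v≡⊥)) = inj₂ (trans u≡⊥ (sym e∧v≡⊥))
        greatest : ∀ W → _≼_ L W X → _≼_ L W Z → _≼_ L W Q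
        greatest W W≼X W≼Z u v r with W≼X u v r | W≼Z u v r
        ... | inj₁ u≡v        | _             = inj₁ u≡v
        ... | inj₂ _          | inj₁ u≡v      = inj₁ u≡v
        ... | inj₂ (u≡⊥ , _) | inj₂ u≡e∧v = inj₂ (u≡⊥ , trans (sym u≡e∧v) u≡⊥)

      non-extremal⇒¬distributive : ¬ WFSDistributive L
      non-extremal⇒¬distributive distributive = ⊥⊤∉Y∨Q (X≼Y∨Q ⊥ ⊤ (inj₂ (refl , tt)))
        where
        X≼Y∨Q : _≼_ L X Y∨Q
        X≼Y∨Q = proj₁ (distributive X Y Z (withBot Z) X Y Q Y∨Q
          Y∨Z≡withBotZ
          (meet-of-≼ {X} {withBot Z} (botArrows≼withBot everything Z))
          (meet-of-≽ {X} {Y} (botArrows-mono {belowE} {everything} _))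
          X∧Z≡Q
          (botArrows-∪ belowE disjointFromE))
        e∧⊤≡e : e ∧ ⊤ ≡ e
        e∧⊤≡e = antisym (x∧y≤x e ⊤) (∧-greatest ⊑-refl (⊤-max e))
        ⊥⊤∉Y∨Q : ¬ BotArrows (member (belowE ∪ˡ disjointFromE)) ⊥ ⊤
        ⊥⊤∉Y∨Q (inj₁ ⊥≡⊤)               = e≢⊥ (⊑⊥⇒≡⊥ (subst (e ⊑_) (sym ⊥≡⊤) (⊤-max e)))
        ⊥⊤∉Y∨Q (inj₂ (_ , inj₁ ⊤⊑e))    = e≢⊤ (antisym (⊤-max e) ⊤⊑e)
        ⊥⊤∉Y∨Q (inj₂ (_ , inj₂ e∧⊤≡⊥)) = e≢⊥ (trans (sym e∧⊤≡e) e∧⊤≡⊥)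

≥3⇒¬distributive : ∀ {k} (L : FiniteLattice (3 + k)) → ¬ WFSDistributive L
≥3⇒¬distributive L =
  let ⊥ , ⊥-min     = minimum L zero
      ⊤ , ⊤-max     = maximum L zero
      e , e≢⊥ , e≢⊤ = avoid₂ ⊥ ⊤
  in non-extremal⇒¬distributive L ⊥ ⊥-min ⊤ ⊤-max e e≢⊥ e≢⊤

distributive⇒≤2 : ∀ {n} (L : FiniteLattice n) → WFSDistributive L → n ≤ 2
distributive⇒≤2 {0}                 _ _ = z≤n
distributive⇒≤2 {1}                 _ _ = s≤s z≤n
distributive⇒≤2 {2}                 _ _ = s≤s (s≤s z≤n)
distributive⇒≤2 {suc (suc (suc _))} L D = ⊥-elim (≥3⇒¬distributive L D)

mainTheorem1 : (n : ℕ) (L : FiniteLattice n) → WFSDistributive L ⇔ n ≤ 2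
mainTheorem1 n L =
  mk⇔ (distributive⇒≤2 L) (total⇒distributive L ∘ ≤2⇒≼-total L)
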